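{- Let $\#,\hat\#\colon\mathbf C\times(\mathbf C\times\mathbf D)\to\mathbf C$ be guarded parametrized monads, with $\#$ guarded pre-iterative, and let $\rho\colon\#\to\hat\#$ be a parametrized guarded monad morphism that is an iteration-congruent retraction. Let $X\#^\nu Z=\nu\gamma.\,X\#(\gamma,Z)$ and $X\hat\#^\nu Z=\nu\gamma.\,X\hat\#(\gamma,Z)$ be the induced guarded parametrized monads (assuming these final coalgebras exist). Then $\rho^\nu\colon\#^\nu\to\hat\#^\nu$ with components $\rho^\nu_{X,Z}=\mathrm{coit}\big(\rho_{X,(X\#^\nu Z,Z)}\circ\mathrm{out}\big)\colon X\#^\nu Z\to X\hat\#^\nu Z$ is again an iteration-congruent retraction.
   Context: A parametrized monad is a bifunctor $\#\colon\mathbf C\times\mathbf E\to\mathbf C$ such that each $(-)\#P$ is a monad (unit $\eta$, lifting $(-)^*$) and each $\mathrm{id}\#p$ is a monad morphism. Summands $\sigma$ of $Y$: pairs of morphisms exhibiting $Y$ as a coproduct; $\bar\sigma$ complement. A monad $M$ is guarded if equipped with a relation $f\colon X\to_\sigma MY$ closed under (trv) $M(\mathrm{inl})\circ f\colon X\to_{\mathrm{inr}}M(Y+Z)$; (par) $f\colon X\to_\sigma MZ$, $g\colon Y\to_\sigma MZ$ imply $[f,g]\colon X+Y\to_\sigma MZ$; (cmp) $f\colon X\to_{\mathrm{inr}}M(Y+Z)$, $g\colon Y\to_\sigma MV$, $h\colon Z\to MV$ imply $[g,h]^*\circ f\colon X\to_\sigma MV$. Guarded pre-iterative: operator assigning to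 $f\colon X\to_{\mathrm{inr}}M(Y+X)$ some $f^\dagger$ with $f^\dagger=[\eta,f^\dagger]^*\circ f$. A parametrized guarded (pre-iterative) monad has all $(-)\#P$ guarded (pre-iterative) and all $\mathrm{id}\#p$ guarded (and iteration-preserving: $(\mathrm{id}\#p)\circ g^\dagger=((\mathrm{id}\#p)\circ g)^\dagger$). A parametrized guarded monad morphism is a natural transformation whose components $\rho_{ -,P}$ are guarded monad morphisms. A guarded retraction $\rho\colon\mathbb T\to\mathbb S$ is a monad morphism with a family $\upsilon_X\colon SX\to TX$, $\rho\circ\upsilon=\mathrm{id}$, with $f\colon X\to_\sigma SY$ implying $\upsilon\circ f\colon X\to_\sigma TY$; an iteration congruence satisfies $\rho\circ f=\rho\circ g\Rightarrow\rho\circ f^\dagger=\rho\circ g^\dagger$ for $f,g\colon X\to_{\mathrm{inr}}T(Y+X)$; a parametrized morphism is such if all its components $\rho_{ -,P}$ are. On $\#^\nu$ ($\mathrm{out}\colon X\#^\nu Z\to X\#(X\#^\nu Z,Z)$, coiteration $\mathrm{coit}$): unit $\eta^\nu$ with $\mathrm{out}\circ\eta^\nu=\eta$; the Kleisli lifting is the one making $\#^\nu$ a monad for each $Z$ (for $f\colon X\to Y\#^\nu Z$, $f^\ddagger$ is the unique map with $[f^\ddagger,\mathrm{id}]$ a coalgebra morphism from $[\bar f^*\circ(\mathrm{id}\#(\mathrm{inl},\mathrm{id}))\circ\mathrm{out},(\mathrm{id}\#(\mathrm{inr},\mathrm{id}))\circ\mathrm{out}]$ to $\mathrm{out}$, where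 $\bar f=(\mathrm{id}\#(\mathrm{inr},\mathrm{id}))\circ\mathrm{out}\circ f$). Guardedness: $f\colon X\to Y\#^\nu Z$ is $\sigma$-guarded iff $\mathrm{out}\circ f$ is $\sigma$-guarded. Iteration: for $f\colon X\to_{\mathrm{inr}}(Y+X)\#^\nu Z$, $f^{\dagger\dagger}=\mathrm{coit}([\eta,(\mathrm{out}\circ f)^\dagger]^*\circ\mathrm{out})\circ\eta^\nu\circ\mathrm{inr}$. The same applies to $\hat\#^\nu$. -}

module Defs where

open import Level using (Level; _⊔_) renaming (suc to lsuc)
open import Data.Product using (Σ; _×_; _,_; proj₁; proj₂)
open import Relation.Binary.PropositionalEquality using (_≡_; refl; cong₂)

record Category (o h : Level) : Set (lsuc (o ⊔ h)) where
  infixr 9 _∘_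
  field
    Obj : Set o
    Hom : Obj → Obj → Set h
    id  : ∀ {A} → Hom A A
    _∘_ : ∀ {A B C} → Hom B C → Hom A B → Hom A C
    identityˡ : ∀ {A B} {f : Hom A B} → id ∘ f ≡ f
    identityʳ : ∀ {A B} {f : Hom A B} → f ∘ id ≡ f
    assoc : ∀ {A B C D} {f : Hom A B} {g : Hom B C} {k : Hom C D} →
            (k ∘ g) ∘ f ≡ k ∘ (g ∘ f)

_⊗_ : ∀ {o h o' h'} → Category o h → Category o' h' → Category (o ⊔ o') (h ⊔ h')
C ⊗ D = record
  { Obj = C.Obj × D.Obj
  ; Hom = λ a b → C.Hom (proj₁ a) (proj₁ b) × D.Hom (proj₂ a) (proj₂ b)
  ; id = C.id , D.id
  ; _∘_ = λ f g → (proj₁ f C.∘ proj₁ g) , (proj₂ f D.∘ proj₂ g)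
  ; identityˡ = cong₂ _,_ C.identityˡ D.identityˡ
  ; identityʳ = cong₂ _,_ C.identityʳ D.identityʳ
  ; assoc = cong₂ _,_ C.assoc D.assoc
  }
  where
    module C = Category C
    module D = Category D

record Coproducts {o h} (C : Category o h) : Set (o ⊔ h) where
  open Category C
  infixl 6 _+_
  field
    _+_ : Obj → Obj → Obj
    inl : ∀ {A B} → Hom A (A + B)
    inr : ∀ {A B} → Hom B (A + B)
    [_,_] : ∀ {A B W} → Hom A W → Hom B W → Hom (A + B) W
    inl-β : ∀ {A B W} {f : Hom A W} {g : Hom B W} → [ f , g ] ∘ inl ≡ f
    inr-β : ∀ {A B W} {f : Hom A W} {g : Hom B W} → [ f , g ] ∘ inr ≡ g
    +-unique : ∀ {A B W} {f : Hom A W} {g : Hom B W} {k : Hom (A + B) W} →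
               k ∘ inl ≡ f → k ∘ inr ≡ g → k ≡ [ f , g ]

-- Summands σ of Y: a pair (s₁ : Y₁ → Y, s₂ : Y₂ → Y) exhibiting Y as a
-- coproduct of Y₁ (the summand σ) and Y₂ (its complement σ̄).
record Summand {o h} (C : Category o h) (Y : Category.Obj C) : Set (o ⊔ h) where
  open Category C
  field
    Y₁ Y₂ : Obj
    s₁ : Hom Y₁ Y
    s₂ : Hom Y₂ Y
    copair : ∀ {W} → Hom Y₁ W → Hom Y₂ W → Hom Y W
    copair-β₁ : ∀ {W} {f : Hom Y₁ W} {g : Hom Y₂ W} → copair f g ∘ s₁ ≡ f
    copair-β₂ : ∀ {W} {f : Hom Y₁ W} {g : Hom Y₂ W} → copair f g ∘ s₂ ≡ g
    copair-unique : ∀ {W} {f : Hom Y₁ W} {g : Hom Y₂ W} {k : Hom Y W} →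
                    k ∘ s₁ ≡ f → k ∘ s₂ ≡ g → k ≡ copair f g

inrS : ∀ {o h} {C : Category o h} (CP : Coproducts C) (Y Z : Category.Obj C) →
       Summand C (Coproducts._+_ CP Y Z)
inrS CP Y Z = record
  { Y₁ = Z ; Y₂ = Y ; s₁ = inr ; s₂ = inl
  ; copair = λ f g → [ g , f ]
  ; copair-β₁ = inr-β ; copair-β₂ = inl-β
  ; copair-unique = λ p q → +-unique q p }
  where open Coproducts CP

module Parametrized {o h o' h'} (C : Category o h) (CP : Coproducts C)
                    (E : Category o' h') where
  open Category C
  open Coproducts CP
  private module E = Category E

  record RawPGM (g : Level) : Set (lsuc g ⊔ o ⊔ h ⊔ o' ⊔ h') where
    infix 20 _*
    field
      F₀ : Obj → E.Obj → Obj
      F₁ : ∀ {X X' P P'} → Hom X X' → E.Hom P P' → Hom (F₀ X P) (F₀ X' P')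
      η  : ∀ {X P} → Hom X (F₀ X P)
      _* : ∀ {X Y P} → Hom X (F₀ Y P) → Hom (F₀ X P) (F₀ Y P)
      Guarded : ∀ {X Y P} → Summand C Y → Hom X (F₀ Y P) → Set g

  record IsPGM {g} (R : RawPGM g) : Set (g ⊔ o ⊔ h ⊔ o' ⊔ h') where
    open RawPGM R
    field
      F-id : ∀ {X P} → F₁ (id {X}) (E.id {P}) ≡ id
      F-∘  : ∀ {X X' X'' P P' P''} {f : Hom X' X''} {f' : Hom X X'}
               {p : E.Hom P' P''} {p' : E.Hom P P'} →
             F₁ (f ∘ f') (p E.∘ p') ≡ F₁ f p ∘ F₁ f' p'
      unitˡ : ∀ {X P} → (η {X} {P}) * ≡ id
      unitʳ : ∀ {X Y P} {f : Hom X (F₀ Y P)} → f * ∘ η ≡ f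
      assoc* : ∀ {X Y W P} {f : Hom X (F₀ Y P)} {k : Hom Y (F₀ W P)} →
               (k * ∘ f) * ≡ k * ∘ f *
      F-lift : ∀ {X Y P} {f : Hom X Y} → F₁ f (E.id {P}) ≡ (η ∘ f) *
      param-η : ∀ {X P P'} {p : E.Hom P P'} → F₁ id p ∘ η {X} {P} ≡ η
      param-* : ∀ {X Y P P'} {p : E.Hom P P'} {f : Hom X (F₀ Y P)} →
                F₁ id p ∘ f * ≡ (F₁ id p ∘ f) * ∘ F₁ id p
      trv : ∀ {X Y Z P} {f : Hom X (F₀ Y P)} →
            Guarded (inrS CP Y Z) (F₁ inl (E.id {P}) ∘ f)
      par : ∀ {X Y Z P} {σ : Summand C Z} {f : Hom X (F₀ Z P)} {k : Hom Y (F₀ Z P)} →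
            Guarded σ f → Guarded σ k → Guarded σ [ f , k ]
      cmp : ∀ {X Y Z V P} {σ : Summand C V} {f : Hom X (F₀ (Y + Z) P)}
              {k : Hom Y (F₀ V P)} {l : Hom Z (F₀ V P)} →
            Guarded (inrS CP Y Z) f → Guarded σ k → Guarded σ ([ k , l ] * ∘ f)
      param-guarded : ∀ {X Y P P'} {p : E.Hom P P'} {σ : Summand C Y} {f : Hom X (F₀ Y P)} →
                      Guarded σ f → Guarded σ (F₁ id p ∘ f)

  record RawIter {g} (R : RawPGM g) : Set (g ⊔ o ⊔ h ⊔ o') where
    open RawPGM R
    field
      dagger : ∀ {X Y P} (f : Hom X (F₀ (Y + X) P)) → .(Guarded (inrS CP Y X) f) →
               Hom X (F₀ Y P)

  record IsPreIterative {g} (R : RawPGM g) (isR : IsPGM R) (I : RawIter R) :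
         Set (g ⊔ o ⊔ h ⊔ o' ⊔ h') where
    open RawPGM R
    open IsPGM isR
    open RawIter I
    field
      fixpoint : ∀ {X Y P} (f : Hom X (F₀ (Y + X) P)) (gf : Guarded (inrS CP Y X) f) →
                 dagger f gf ≡ [ η , dagger f gf ] * ∘ f
      param-iter : ∀ {X Y P P'} {p : E.Hom P P'} (f : Hom X (F₀ (Y + X) P))
                     (gf : Guarded (inrS CP Y X) f) →
                   F₁ id p ∘ dagger f gf ≡ dagger (F₁ id p ∘ f) (param-guarded gf)

  module _ {g ĝ} (R : RawPGM g) (S : RawPGM ĝ) where
    private
      module R = RawPGM R
      module S = RawPGM S

    Components : Set (o ⊔ h ⊔ o')
    Components = ∀ {X P} → Hom (R.F₀ X P) (S.F₀ X P)

    record IsPGMMorphism (ρ : Components) : Set (g ⊔ ĝ ⊔ o ⊔ h ⊔ o' ⊔ h') where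
      field
        natural : ∀ {X X' P P'} {f : Hom X X'} {p : E.Hom P P'} →
                  ρ ∘ R.F₁ f p ≡ S.F₁ f p ∘ ρ
        mor-η : ∀ {X P} → ρ ∘ R.η {X} {P} ≡ S.η
        mor-* : ∀ {X Y P} {f : Hom X (R.F₀ Y P)} → ρ ∘ f R.* ≡ (ρ ∘ f) S.* ∘ ρ
        mor-guarded : ∀ {X Y P} {σ : Summand C Y} {f : Hom X (R.F₀ Y P)} →
                      R.Guarded σ f → S.Guarded σ (ρ ∘ f)

    record IsGuardedRetraction (ρ : Components)
           (υ : ∀ {X P} → Hom (S.F₀ X P) (R.F₀ X P)) : Set (g ⊔ ĝ ⊔ o ⊔ h ⊔ o') where
      field
        retract : ∀ {X P} → ρ {X} {P} ∘ υ ≡ id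
        υ-guarded : ∀ {X Y P} {σ : Summand C Y} {f : Hom X (S.F₀ Y P)} →
                    S.Guarded σ f → R.Guarded σ (υ ∘ f)

    IsIterationCongruence : RawIter R → Components → Set (g ⊔ o ⊔ h ⊔ o')
    IsIterationCongruence I ρ =
      ∀ {X Y P} (f k : Hom X (R.F₀ (Y + X) P))
        (gf : R.Guarded (inrS CP Y X) f) (gk : R.Guarded (inrS CP Y X) k) →
      ρ ∘ f ≡ ρ ∘ k → ρ ∘ RawIter.dagger I f gf ≡ ρ ∘ RawIter.dagger I k gk

    IsIterCongruentRetraction : RawIter R → Components → Set (g ⊔ ĝ ⊔ o ⊔ h ⊔ o' ⊔ h')
    IsIterCongruentRetraction I ρ =
      IsPGMMorphism ρ ×
      (Σ (∀ {X P} → Hom (S.F₀ X P) (R.F₀ X P)) λ υ → IsGuardedRetraction ρ υ) ×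
      IsIterationCongruence I ρ

module Nu {o h o' h'} (C : Category o h) (CP : Coproducts C) (D : Category o' h') where
  open Category C
  open Coproducts CP
  private module D = Category D
  open Parametrized C CP (C ⊗ D) using (RawPGM; RawIter)
  module PD = Parametrized C CP D

  record FinalCoalgebras {g} (R : RawPGM g) : Set (o ⊔ h ⊔ o' ⊔ h') where
    open RawPGM R
    field
      ν : Obj → D.Obj → Obj
      out : ∀ {X Z} → Hom (ν X Z) (F₀ X (ν X Z , Z))
      coit : ∀ {X Z A} → Hom A (F₀ X (A , Z)) → Hom A (ν X Z)
      coit-law : ∀ {X Z A} {c : Hom A (F₀ X (A , Z))} →
                 out ∘ coit c ≡ F₁ id (coit c , D.id) ∘ c
      coit-unique : ∀ {X Z A} {c : Hom A (F₀ X (A , Z))} {k : Hom A (ν X Z)} →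
                    out ∘ k ≡ F₁ id (k , D.id) ∘ c → k ≡ coit c

  module _ {g} {R : RawPGM g} (FC : FinalCoalgebras R) where
    open RawPGM R
    open FinalCoalgebras FC

    -- unit: the unique η^ν with out ∘ η^ν = η  (η^ν = out⁻¹ ∘ η)
    ην : ∀ {X Z} → Hom X (ν X Z)
    ην {X} {Z} = coit {X} {Z} (F₁ id (out {X} {Z} , D.id)) ∘ η

    -- Kleisli lifting f^‡ = [f^‡ , id] ∘ inl where [f^‡ , id] is the coalgebra morphism
    liftν : ∀ {X Y Z} → Hom X (ν Y Z) → Hom (ν X Z) (ν Y Z)
    liftν {X} {Y} {Z} f = coit {Y} {Z} coalg ∘ inl
      where
        fbar : Hom X (F₀ Y (ν X Z + ν Y Z , Z))
        fbar = F₁ id (inr , D.id) ∘ out ∘ f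
        coalg : Hom (ν X Z + ν Y Z) (F₀ Y (ν X Z + ν Y Z , Z))
        coalg = [ fbar * ∘ F₁ id (inl , D.id) ∘ out , F₁ id (inr , D.id) ∘ out ]

    nuRaw : PD.RawPGM g
    nuRaw = record
      { F₀ = ν
      ; F₁ = λ f k → coit (F₁ f (id , k) ∘ out)
      ; η = ην
      ; _* = liftν
      ; Guarded = λ σ f → Guarded σ (out ∘ f)
      }

    nuIter : RawIter R → PD.RawIter nuRaw
    nuIter I = record
      { dagger = λ {X} {Y} {Z} f gf →
          coit {Y} {Z} ([ η , RawIter.dagger I (out ∘ f) gf ] * ∘ out) ∘ ην ∘ inr }

  rhoNu : ∀ {g ĝ} {R : RawPGM g} {S : RawPGM ĝ}
          (FR : FinalCoalgebras R) (FS : FinalCoalgebras S) →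
          Parametrized.Components C CP (C ⊗ D) R S →
          PD.Components (nuRaw FR) (nuRaw FS)
  rhoNu FR FS ρ = FinalCoalgebras.coit FS (ρ ∘ FinalCoalgebras.out FR)

-- For m : A → B write ρ⟨ m ⟩ = (id # (m , id)) ∘ ρ : X # (A , Z) → X #̂ (B , Z).
-- By naturality of ρ each ρ⟨ m ⟩ is again a guarded monad morphism and an iteration
-- congruence. Call m a simulation from a #-coalgebra c to a #̂-coalgebra c' when
-- c' ∘ m = ρ⟨ m ⟩ ∘ c; finality then gives coit c' ∘ m = ρ^ν ∘ coit c. Every law of ρ^ν
-- is such an instance: naturality and iteration along m = ρ^ν, Kleisli lifting along
-- ρ^ν + ρ^ν; the section of ρ^ν is υ^ν = coit (υ ∘ out).

module Submission where

open import Data.Product using (_,_)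
open import Relation.Binary.PropositionalEquality
  using (_≡_; refl; sym; trans; cong; cong₂; subst; module ≡-Reasoning)
open import Defs

module CategoryFacts {o h} (C : Category o h) where
  open Category C

  pullˡ : ∀ {A B B' W} {a : Hom B W} {b : Hom B' B} {c : Hom B' W} {f : Hom A B'} →
          a ∘ b ≡ c → a ∘ (b ∘ f) ≡ c ∘ f
  pullˡ {f = f} e = trans (sym assoc) (cong (_∘ f) e)

  pullʳ : ∀ {A B B' W} {a : Hom B' B} {b : Hom A B'} {c : Hom A B} {f : Hom B W} →
          a ∘ b ≡ c → (f ∘ a) ∘ b ≡ f ∘ c
  pullʳ {f = f} e = trans assoc (cong (f ∘_) e)

  extendʳ : ∀ {A B B₁ B₂ W} {a : Hom B₁ W} {b : Hom B B₁} {c : Hom B₂ W} {d : Hom B B₂}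
              {f : Hom A B} →
            a ∘ b ≡ c ∘ d → a ∘ (b ∘ f) ≡ c ∘ (d ∘ f)
  extendʳ e = trans (pullˡ e) assoc

module CoproductFacts {o h} {C : Category o h} (CP : Coproducts C) where
  open Category C
  open Coproducts CP

  ∘-[,] : ∀ {A B W V} {f : Hom A W} {k : Hom B W} {l : Hom W V} →
          l ∘ [ f , k ] ≡ [ l ∘ f , l ∘ k ]
  ∘-[,] = +-unique (trans assoc (cong (_ ∘_) inl-β)) (trans assoc (cong (_ ∘_) inr-β))

  _+₁_ : ∀ {A A' B B'} → Hom A A' → Hom B B' → Hom (A + B) (A' + B')
  f +₁ k = [ inl ∘ f , inr ∘ k ]

  [,]∘+₁ : ∀ {A A' B B' W} {a : Hom A' W} {b : Hom B' W} {f : Hom A A'} {k : Hom B B'} →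
           [ a , b ] ∘ (f +₁ k) ≡ [ a ∘ f , b ∘ k ]
  [,]∘+₁ = trans ∘-[,] (cong₂ [_,_] (pullˡ inl-β) (pullˡ inr-β))
    where open CategoryFacts C

module FinalCoalgebraFacts {o h o' h' g} {C : Category o h} {CP : Coproducts C}
    {D : Category o' h'} {R : Parametrized.RawPGM C CP (C ⊗ D) g}
    (isR : Parametrized.IsPGM C CP (C ⊗ D) R) (FR : Nu.FinalCoalgebras C CP D R) where
  open Category C
  private module D = Category D
  open Parametrized.RawPGM R
  open Parametrized.IsPGM isR
  open Nu.FinalCoalgebras FR public
  open CategoryFacts C

  mapγ : ∀ {X A B Z} → Hom A B → Hom (F₀ X (A , Z)) (F₀ X (B , Z))
  mapγ a = F₁ id (a , D.id)

  mapγ-∘ : ∀ {X A B B' Z} {a : Hom B B'} {b : Hom A B} →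
           mapγ {X} {Z = Z} a ∘ mapγ b ≡ mapγ (a ∘ b)
  mapγ-∘ = trans (sym F-∘) (cong₂ F₁ identityˡ (cong₂ _,_ refl D.identityˡ))

  mapγ-comm : ∀ {X X' Z Z' A B} {f : Hom X X'} {k : D.Hom Z Z'} {m : Hom A B} →
              F₁ f (id , k) ∘ mapγ m ≡ mapγ m ∘ F₁ f (id , k)
  mapγ-comm = trans (sym F-∘) (trans (cong₂ F₁ (trans identityʳ (sym identityˡ))
    (cong₂ _,_ (trans identityˡ (sym identityʳ)) (trans D.identityʳ (sym D.identityˡ)))) F-∘)

  coit-out : ∀ {X Z} → coit (out {X} {Z}) ≡ id
  coit-out = sym (coit-unique (trans identityʳ (trans (sym identityˡ) (cong (_∘ out) (sym F-id)))))

  coit-fusion : ∀ {X Z A B} {cA : Hom A (F₀ X (A , Z))} {cB : Hom B (F₀ X (B , Z))}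
                  {m : Hom A B} →
                cB ∘ m ≡ mapγ m ∘ cA → coit cB ∘ m ≡ coit cA
  coit-fusion {cA = cA} {cB} {m} e = coit-unique (begin
    out ∘ (coit cB ∘ m)               ≡⟨ pullˡ coit-law ⟩
    (mapγ (coit cB) ∘ cB) ∘ m         ≡⟨ pullʳ e ⟩
    mapγ (coit cB) ∘ (mapγ m ∘ cA)    ≡⟨ pullˡ mapγ-∘ ⟩
    mapγ (coit cB ∘ m) ∘ cA           ∎)
    where open ≡-Reasoning

  out⁻¹ : ∀ {X Z} → Hom (F₀ X (ν X Z , Z)) (ν X Z)
  out⁻¹ = coit (mapγ out)

  out⁻¹∘out : ∀ {X Z} → out⁻¹ {X} {Z} ∘ out ≡ id
  out⁻¹∘out = trans (coit-fusion refl) coit-out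

  out-injective : ∀ {A X Z} {a b : Hom A (ν X Z)} → out ∘ a ≡ out ∘ b → a ≡ b
  out-injective {a = a} {b} e = begin
    a                   ≡⟨ sym (trans (pullˡ out⁻¹∘out) identityˡ) ⟩
    out⁻¹ ∘ (out ∘ a)   ≡⟨ cong (out⁻¹ ∘_) e ⟩
    out⁻¹ ∘ (out ∘ b)   ≡⟨ trans (pullˡ out⁻¹∘out) identityˡ ⟩
    b                   ∎
    where open ≡-Reasoning

  out∘out⁻¹ : ∀ {X Z} → out ∘ out⁻¹ {X} {Z} ≡ id
  out∘out⁻¹ = trans coit-law (trans mapγ-∘ (trans (cong mapγ out⁻¹∘out) F-id))

  out∘ην : ∀ {X Z} → out ∘ Nu.ην C CP D FR {X} {Z} ≡ η
  out∘ην = trans (pullˡ out∘out⁻¹) identityˡ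

module NuMorphism {o h o' h' g ĝ} {C : Category o h} {CP : Coproducts C} {D : Category o' h'}
    {R : Parametrized.RawPGM C CP (C ⊗ D) g} {S : Parametrized.RawPGM C CP (C ⊗ D) ĝ}
    (isR : Parametrized.IsPGM C CP (C ⊗ D) R) (isS : Parametrized.IsPGM C CP (C ⊗ D) S)
    {ρ : Parametrized.Components C CP (C ⊗ D) R S}
    (isρ : Parametrized.IsPGMMorphism C CP (C ⊗ D) R S ρ)
    (FR : Nu.FinalCoalgebras C CP D R) (FS : Nu.FinalCoalgebras C CP D S) where
  open Category C
  open Coproducts CP
  private module D = Category D
  open Parametrized C CP (C ⊗ D)
  private
    module R = RawPGM R
    module S = RawPGM S
    module isR = IsPGM isR
    module isS = IsPGM isS
    module NR = FinalCoalgebraFacts isR FR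
    module NS = FinalCoalgebraFacts isS FS
  open IsPGMMorphism isρ
  open CategoryFacts C
  open CoproductFacts CP
  open ≡-Reasoning

  ρν : ∀ {X Z} → Hom (NR.ν X Z) (NS.ν X Z)
  ρν = Nu.rhoNu C CP D FR FS ρ

  ρ⟨_⟩ : ∀ {X A B Z} → Hom A B → Hom (R.F₀ X (A , Z)) (S.F₀ X (B , Z))
  ρ⟨ m ⟩ = NS.mapγ m ∘ ρ

  ρ∘mapγ : ∀ {W X A B Z} {m : Hom A B} {k : Hom W (R.F₀ X (A , Z))} →
           ρ ∘ (NR.mapγ m ∘ k) ≡ ρ⟨ m ⟩ ∘ k
  ρ∘mapγ = pullˡ natural

  ρ⟨⟩∘mapγ : ∀ {X A B B' Z} {m : Hom B B'} {i : Hom A B} →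
             ρ⟨ m ⟩ ∘ NR.mapγ {X} {Z = Z} i ≡ ρ⟨ m ∘ i ⟩
  ρ⟨⟩∘mapγ = trans (pullʳ natural) (pullˡ NS.mapγ-∘)

  mapγ∘ρ⟨⟩ : ∀ {X A B B' Z} {j : Hom B B'} {m : Hom A B} →
             NS.mapγ {X} {Z = Z} j ∘ ρ⟨ m ⟩ ≡ ρ⟨ j ∘ m ⟩
  mapγ∘ρ⟨⟩ = pullˡ NS.mapγ-∘

  ρ⟨⟩-comm : ∀ {X X' Z Z' A B} {f : Hom X X'} {k : D.Hom Z Z'} {m : Hom A B} →
             ρ⟨ m ⟩ ∘ R.F₁ f (id , k) ≡ S.F₁ f (id , k) ∘ ρ⟨ m ⟩
  ρ⟨⟩-comm {f = f} {k} {m} = begin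
    (NS.mapγ m ∘ ρ) ∘ R.F₁ f (id , k)   ≡⟨ pullʳ natural ⟩
    NS.mapγ m ∘ (S.F₁ f (id , k) ∘ ρ)   ≡⟨ pullˡ (sym NS.mapγ-comm) ⟩
    (S.F₁ f (id , k) ∘ NS.mapγ m) ∘ ρ   ≡⟨ assoc ⟩
    S.F₁ f (id , k) ∘ ρ⟨ m ⟩            ∎

  ρ⟨⟩-η : ∀ {X A B Z} {m : Hom A B} → ρ⟨ m ⟩ ∘ R.η {X} {A , Z} ≡ S.η
  ρ⟨⟩-η = trans (pullʳ mor-η) isS.param-η

  ρ⟨⟩-* : ∀ {X Y A B Z} {m : Hom A B} {k : Hom X (R.F₀ Y (A , Z))} →
          ρ⟨ m ⟩ ∘ k R.* ≡ (ρ⟨ m ⟩ ∘ k) S.* ∘ ρ⟨ m ⟩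
  ρ⟨⟩-* {m = m} {k} = begin
    (NS.mapγ m ∘ ρ) ∘ k R.*                          ≡⟨ pullʳ mor-* ⟩
    NS.mapγ m ∘ ((ρ ∘ k) S.* ∘ ρ)                    ≡⟨ pullˡ isS.param-* ⟩
    ((NS.mapγ m ∘ (ρ ∘ k)) S.* ∘ NS.mapγ m) ∘ ρ      ≡⟨ assoc ⟩
    (NS.mapγ m ∘ (ρ ∘ k)) S.* ∘ ρ⟨ m ⟩               ≡⟨ cong (λ l → l S.* ∘ ρ⟨ m ⟩) (sym assoc) ⟩
    (ρ⟨ m ⟩ ∘ k) S.* ∘ ρ⟨ m ⟩                        ∎

  ρ⟨⟩∘[η,-] : ∀ {X Y A B Z} {m : Hom A B} {k : Hom X (R.F₀ Y (A , Z))} →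
              ρ⟨ m ⟩ ∘ [ R.η , k ] ≡ [ S.η , ρ⟨ m ⟩ ∘ k ]
  ρ⟨⟩∘[η,-] {m = m} {k} = trans ∘-[,] (cong [_, ρ⟨ m ⟩ ∘ k ] ρ⟨⟩-η)

  ρ⟨⟩-guarded : ∀ {W X A B Z} {σ : Summand C X} {m : Hom A B} {k : Hom W (R.F₀ X (A , Z))} →
                R.Guarded σ k → S.Guarded σ (ρ⟨ m ⟩ ∘ k)
  ρ⟨⟩-guarded {σ = σ} gk = subst (S.Guarded σ) (sym assoc) (isS.param-guarded (mor-guarded gk))

  out∘ρν : ∀ {X Z} → NS.out ∘ ρν {X} {Z} ≡ ρ⟨ ρν ⟩ ∘ NR.out
  out∘ρν = trans NS.coit-law (sym assoc)

  ρν∘coit : ∀ {X Z A} {c : Hom A (R.F₀ X (A , Z))} → ρν ∘ NR.coit c ≡ NS.coit (ρ ∘ c)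
  ρν∘coit {c = c} = NS.coit-fusion (begin
    (ρ ∘ NR.out) ∘ NR.coit c                 ≡⟨ pullʳ NR.coit-law ⟩
    ρ ∘ (NR.mapγ (NR.coit c) ∘ c)            ≡⟨ extendʳ natural ⟩
    NS.mapγ (NR.coit c) ∘ (ρ ∘ c)            ∎)

  coit-simulation : ∀ {X Z A B} {cR : Hom A (R.F₀ X (A , Z))} {cS : Hom B (S.F₀ X (B , Z))}
                      {m : Hom A B} →
                    cS ∘ m ≡ ρ⟨ m ⟩ ∘ cR → NS.coit cS ∘ m ≡ ρν ∘ NR.coit cR
  coit-simulation e = trans (NS.coit-fusion (trans e assoc)) (sym ρν∘coit)

  mapγ-out-ρν : ∀ {V Z A B} {i : Hom (NR.ν V Z) A} {j : Hom (NS.ν V Z) B} {m : Hom A B} →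
                j ∘ ρν ≡ m ∘ i → (NS.mapγ j ∘ NS.out) ∘ ρν ≡ ρ⟨ m ⟩ ∘ (NR.mapγ i ∘ NR.out)
  mapγ-out-ρν {i = i} {j} {m} e = begin
    (NS.mapγ j ∘ NS.out) ∘ ρν       ≡⟨ pullʳ out∘ρν ⟩
    NS.mapγ j ∘ (ρ⟨ ρν ⟩ ∘ NR.out)  ≡⟨ pullˡ mapγ∘ρ⟨⟩ ⟩
    ρ⟨ j ∘ ρν ⟩ ∘ NR.out            ≡⟨ cong (λ l → ρ⟨ l ⟩ ∘ NR.out) e ⟩
    ρ⟨ m ∘ i ⟩ ∘ NR.out             ≡⟨ pullˡ ρ⟨⟩∘mapγ ⟨
    ρ⟨ m ⟩ ∘ (NR.mapγ i ∘ NR.out)   ∎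

  natural-ν : ∀ {X X' Z Z'} {f : Hom X X'} {k : D.Hom Z Z'} →
              ρν ∘ NR.coit (R.F₁ f (id , k) ∘ NR.out) ≡ NS.coit (S.F₁ f (id , k) ∘ NS.out) ∘ ρν
  natural-ν = sym (coit-simulation (trans (pullʳ out∘ρν) (extendʳ (sym ρ⟨⟩-comm))))

  mor-η-ν : ∀ {X Z} → ρν ∘ Nu.ην C CP D FR {X} {Z} ≡ Nu.ην C CP D FS
  mor-η-ν = NS.out-injective (begin
    NS.out ∘ (ρν ∘ Nu.ην C CP D FR)      ≡⟨ pullˡ out∘ρν ⟩
    (ρ⟨ ρν ⟩ ∘ NR.out) ∘ Nu.ην C CP D FR ≡⟨ pullʳ NR.out∘ην ⟩
    ρ⟨ ρν ⟩ ∘ R.η                        ≡⟨ ρ⟨⟩-η ⟩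
    S.η                                  ≡⟨ NS.out∘ην ⟨
    NS.out ∘ Nu.ην C CP D FS             ∎)

  -- The Kleisli extension is coiterated on ν X Z + ν Y Z, where ρν + ρν is a simulation.
  mor-*-ν : ∀ {X Y Z} {f : Hom X (NR.ν Y Z)} →
            ρν ∘ Nu.liftν C CP D FR f ≡ Nu.liftν C CP D FS (ρν ∘ f) ∘ ρν
  mor-*-ν {X} {Y} {Z} {f} = begin
    ρν ∘ (NR.coit cR ∘ inl)       ≡⟨ pullˡ (sym (coit-simulation simulation)) ⟩
    (NS.coit cS ∘ m) ∘ inl        ≡⟨ pullʳ inl-β ⟩
    NS.coit cS ∘ (inl ∘ ρν)       ≡⟨ assoc ⟨
    (NS.coit cS ∘ inl) ∘ ρν       ∎
    where
      m : Hom (NR.ν X Z + NR.ν Y Z) (NS.ν X Z + NS.ν Y Z)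
      m = ρν +₁ ρν
      fR = NR.mapγ inr ∘ NR.out ∘ f
      fS = NS.mapγ inr ∘ NS.out ∘ (ρν ∘ f)
      cR = [ fR R.* ∘ NR.mapγ inl ∘ NR.out , NR.mapγ inr ∘ NR.out ]
      cS = [ fS S.* ∘ NS.mapγ inl ∘ NS.out , NS.mapγ inr ∘ NS.out ]

      shiftˡ = NR.mapγ inl ∘ NR.out {X} {Z}

      inl-case : (NS.mapγ inl ∘ NS.out) ∘ ρν ≡ ρ⟨ m ⟩ ∘ shiftˡ
      inl-case = mapγ-out-ρν (sym inl-β)

      inr-case : (NS.mapγ inr ∘ NS.out) ∘ ρν ≡ ρ⟨ m ⟩ ∘ (NR.mapγ inr ∘ NR.out {Y} {Z})
      inr-case = mapγ-out-ρν (sym inr-β)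

      fS≡ : fS ≡ ρ⟨ m ⟩ ∘ fR
      fS≡ = begin
        NS.mapγ inr ∘ (NS.out ∘ (ρν ∘ f))       ≡⟨ assoc ⟨
        (NS.mapγ inr ∘ NS.out) ∘ (ρν ∘ f)       ≡⟨ pullˡ inr-case ⟩
        (ρ⟨ m ⟩ ∘ (NR.mapγ inr ∘ NR.out)) ∘ f   ≡⟨ trans assoc (cong (ρ⟨ m ⟩ ∘_) assoc) ⟩
        ρ⟨ m ⟩ ∘ fR                             ∎

      inl-component : (fS S.* ∘ NS.mapγ inl ∘ NS.out) ∘ ρν ≡ ρ⟨ m ⟩ ∘ (fR R.* ∘ shiftˡ)
      inl-component = begin
        (fS S.* ∘ NS.mapγ inl ∘ NS.out) ∘ ρν      ≡⟨ pullʳ inl-case ⟩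
        fS S.* ∘ (ρ⟨ m ⟩ ∘ shiftˡ)                ≡⟨ cong (λ l → l S.* ∘ (ρ⟨ m ⟩ ∘ shiftˡ)) fS≡ ⟩
        (ρ⟨ m ⟩ ∘ fR) S.* ∘ (ρ⟨ m ⟩ ∘ shiftˡ)     ≡⟨ extendʳ (sym ρ⟨⟩-*) ⟩
        ρ⟨ m ⟩ ∘ (fR R.* ∘ shiftˡ)                ∎

      simulation : cS ∘ m ≡ ρ⟨ m ⟩ ∘ cR
      simulation = trans [,]∘+₁ (trans (cong₂ [_,_] inl-component inr-case) (sym ∘-[,]))

  mor-guarded-ν : ∀ {X Y Z} {σ : Summand C Y} {f : Hom X (NR.ν Y Z)} →
                  R.Guarded σ (NR.out ∘ f) → S.Guarded σ (NS.out ∘ (ρν ∘ f))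
  mor-guarded-ν {σ = σ} gf = subst (S.Guarded σ) (sym (extendʳ out∘ρν)) (ρ⟨⟩-guarded gf)

  isPGMMorphism-ν : Parametrized.IsPGMMorphism C CP D (Nu.nuRaw C CP D FR) (Nu.nuRaw C CP D FS) ρν
  isPGMMorphism-ν = record
    { natural = natural-ν ; mor-η = mor-η-ν ; mor-* = mor-*-ν ; mor-guarded = mor-guarded-ν }

  υν : (∀ {X P} → Hom (S.F₀ X P) (R.F₀ X P)) → ∀ {X Z} → Hom (NS.ν X Z) (NR.ν X Z)
  υν υ = NR.coit (υ ∘ NS.out)

  isGuardedRetraction-ν : ∀ {υ : ∀ {X P} → Hom (S.F₀ X P) (R.F₀ X P)} →
                          IsGuardedRetraction R S ρ υ →
                          Parametrized.IsGuardedRetraction C CP D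
                            (Nu.nuRaw C CP D FR) (Nu.nuRaw C CP D FS) ρν (υν υ)
  isGuardedRetraction-ν {υ} isυ = record { retract = retract-ν ; υ-guarded = υν-guarded }
    where
      open IsGuardedRetraction isυ

      retract-ν : ∀ {X Z} → ρν ∘ υν υ {X} {Z} ≡ id
      retract-ν = begin
        ρν ∘ NR.coit (υ ∘ NS.out)   ≡⟨ ρν∘coit ⟩
        NS.coit (ρ ∘ (υ ∘ NS.out))  ≡⟨ cong NS.coit (trans (pullˡ retract) identityˡ) ⟩
        NS.coit NS.out              ≡⟨ NS.coit-out ⟩
        id                          ∎

      υν-guarded : ∀ {X Y Z} {σ : Summand C Y} {f : Hom X (NS.ν Y Z)} →
                   S.Guarded σ (NS.out ∘ f) → R.Guarded σ (NR.out ∘ (υν υ ∘ f))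
      υν-guarded {σ = σ} gf = subst (R.Guarded σ) (sym (trans (pullˡ NR.coit-law) (pullʳ assoc)))
                                    (isR.param-guarded (υ-guarded gf))

  ρν∘coit-iterate : ∀ {X Y Z} {d : Hom X (R.F₀ Y (NR.ν (Y + X) Z , Z))} →
                    ρν ∘ NR.coit ([ R.η , d ] R.* ∘ NR.out)
                    ≡ NS.coit ([ S.η , ρ⟨ ρν ⟩ ∘ d ] S.* ∘ NS.out) ∘ ρν
  ρν∘coit-iterate {d = d} = sym (coit-simulation (begin
    ([ S.η , ρ⟨ ρν ⟩ ∘ d ] S.* ∘ NS.out) ∘ ρν
      ≡⟨ pullʳ out∘ρν ⟩
    [ S.η , ρ⟨ ρν ⟩ ∘ d ] S.* ∘ (ρ⟨ ρν ⟩ ∘ NR.out)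
      ≡⟨ cong (λ l → l S.* ∘ (ρ⟨ ρν ⟩ ∘ NR.out)) ρ⟨⟩∘[η,-] ⟨
    (ρ⟨ ρν ⟩ ∘ [ R.η , d ]) S.* ∘ (ρ⟨ ρν ⟩ ∘ NR.out)
      ≡⟨ extendʳ (sym ρ⟨⟩-*) ⟩
    ρ⟨ ρν ⟩ ∘ ([ R.η , d ] R.* ∘ NR.out)
      ∎))

  module _ {I : RawIter R} (isI : IsPreIterative R isR I)
           (congruence : IsIterationCongruence R S I ρ) where
    open RawIter I
    open IsPreIterative isI

    ρ⟨⟩-dagger : ∀ {X Y A B Z} {m : Hom A B} (k : Hom X (R.F₀ (Y + X) (A , Z)))
                   (gk : R.Guarded (inrS CP Y X) k) →
                 ρ⟨ m ⟩ ∘ dagger k gk ≡ ρ ∘ dagger (NR.mapγ m ∘ k) (isR.param-guarded gk)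
    ρ⟨⟩-dagger k gk = trans (sym ρ∘mapγ) (cong (ρ ∘_) (param-iter k gk))

    ρ⟨⟩-congruence : ∀ {X Y A B Z} {m : Hom A B} (k l : Hom X (R.F₀ (Y + X) (A , Z)))
                       (gk : R.Guarded (inrS CP Y X) k) (gl : R.Guarded (inrS CP Y X) l) →
                     ρ⟨ m ⟩ ∘ k ≡ ρ⟨ m ⟩ ∘ l → ρ⟨ m ⟩ ∘ dagger k gk ≡ ρ⟨ m ⟩ ∘ dagger l gl
    ρ⟨⟩-congruence {m = m} k l gk gl e = begin
      ρ⟨ m ⟩ ∘ dagger k gk
        ≡⟨ ρ⟨⟩-dagger k gk ⟩
      ρ ∘ dagger (NR.mapγ m ∘ k) (isR.param-guarded gk)
        ≡⟨ congruence _ _ (isR.param-guarded gk) (isR.param-guarded gl)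
                        (trans ρ∘mapγ (trans e (sym ρ∘mapγ))) ⟩
      ρ ∘ dagger (NR.mapγ m ∘ l) (isR.param-guarded gl)
        ≡⟨ ρ⟨⟩-dagger {m = m} l gl ⟨
      ρ⟨ m ⟩ ∘ dagger l gl
        ∎

    isIterationCongruence-ν : Parametrized.IsIterationCongruence C CP D
                                (Nu.nuRaw C CP D FR) (Nu.nuRaw C CP D FS)
                                (Nu.nuIter C CP D FR I) ρν
    isIterationCongruence-ν f k gf gk e = begin
      ρν ∘ (NR.coit (iterateᴿ (dagger (NR.out ∘ f) gf)) ∘ start)
        ≡⟨ pullˡ ρν∘coit-iterate ⟩
      (NS.coit (iterateˢ (ρ⟨ ρν ⟩ ∘ dagger (NR.out ∘ f) gf)) ∘ ρν) ∘ start
        ≡⟨ cong (λ d → (NS.coit (iterateˢ d) ∘ ρν) ∘ start) same-dagger ⟩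
      (NS.coit (iterateˢ (ρ⟨ ρν ⟩ ∘ dagger (NR.out ∘ k) gk)) ∘ ρν) ∘ start
        ≡⟨ pullˡ ρν∘coit-iterate ⟨
      ρν ∘ (NR.coit (iterateᴿ (dagger (NR.out ∘ k) gk)) ∘ start)
        ∎
      where
        start = Nu.ην C CP D FR ∘ inr
        iterateᴿ = λ d → [ R.η , d ] R.* ∘ NR.out
        iterateˢ = λ d → [ S.η , d ] S.* ∘ NS.out

        same-dagger : ρ⟨ ρν ⟩ ∘ dagger (NR.out ∘ f) gf ≡ ρ⟨ ρν ⟩ ∘ dagger (NR.out ∘ k) gk
        same-dagger = ρ⟨⟩-congruence _ _ gf gk
          (trans (sym (extendʳ out∘ρν)) (trans (cong (NS.out ∘_) e) (extendʳ out∘ρν)))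

theorem5p10 : ∀ {o h o' h' g ĝ}
    (C : Category o h) (CP : Coproducts C) (D : Category o' h')
    (R : Parametrized.RawPGM C CP (C ⊗ D) g)
    (S : Parametrized.RawPGM C CP (C ⊗ D) ĝ)
    (isR : Parametrized.IsPGM C CP (C ⊗ D) R)
    (isS : Parametrized.IsPGM C CP (C ⊗ D) S)
    (I : Parametrized.RawIter C CP (C ⊗ D) R)
    (isI : Parametrized.IsPreIterative C CP (C ⊗ D) R isR I)
    (ρ : Parametrized.Components C CP (C ⊗ D) R S)
    (ρ-icr : Parametrized.IsIterCongruentRetraction C CP (C ⊗ D) R S I ρ)
    (FR : Nu.FinalCoalgebras C CP D R)
    (FS : Nu.FinalCoalgebras C CP D S) →
    Parametrized.IsIterCongruentRetraction C CP D
      (Nu.nuRaw C CP D FR) (Nu.nuRaw C CP D FS)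
      (Nu.nuIter C CP D FR I) (Nu.rhoNu C CP D FR FS ρ)
theorem5p10 C CP D R S isR isS I isI ρ (isρ , (υ , isυ) , congruence) FR FS =
  isPGMMorphism-ν , (υν υ , isGuardedRetraction-ν isυ) , isIterationCongruence-ν isI congruence
  where open NuMorphism isR isS isρ FR FS
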